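{- Let $a,b,p,q$ be complex numbers with $p\neq 0$, $q\neq 0$. For every non-negative integer $k$ and all integers $r$ and $m$ with $v_r\neq 0$: \[ \sum_{j=0}^k \frac{w_{m-kr+r+rj}}{(q^r/v_r)^j} = \frac{v_r w_m}{(q^r/v_r)^k} - q^r w_{m-(k+1)r}, \] \[ v_r^k q^r\sum_{j=0}^k \frac{w_{m-r+rj}}{v_r^j} = v_r^{k+1}w_m - w_{m+(k+1)r}, \] \[ v_r\sum_{j=0}^k \frac{w_{m-2kr-r+2rj}}{(-q^r)^j} = \frac{w_m}{(-q^r)^k} + q^r w_{m-2(k+1)r}. \]
   Context: The sequence $\{w_n\}=\{w_n(a,b;p,q)\}$ is defined by $w_0=a$, $w_1=b$, $w_n=pw_{n-1}-qw_{n-2}$ for $n\ge 2$, and extended to negative indices by $w_{ -n}=(pw_{ -n+1}-w_{ -n+2})/q$, so that $w_n=pw_{n-1}-qw_{n-2}$ holds for all integers $n$. The sequence $v_n=v_n(p,q)$ is $w_n(2,p;p,q)$, i.e. $v_0=2$, $v_1=p$, $v_n=pv_{n-1}-qv_{n-2}$ for all integers $n$. -}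

module Defs where

open import Level using (_⊔_)
open import Algebra.Bundles using (CommutativeRing)
open import Data.Nat using (ℕ; zero; suc)
open import Data.Integer using (ℤ; +_; -[1+_])
open import Relation.Nullary using (¬_)

-- The inverse is a total operation
-- (its value at 0 is unspecified), respecting the setoid equality.
record Field c ℓ : Set (Level.suc (c ⊔ ℓ)) where
  field
    commutativeRing : CommutativeRing c ℓ
  open CommutativeRing commutativeRing public
  field
    _⁻¹       : Carrier → Carrier
    ⁻¹-cong   : ∀ {x y} → x ≈ y → x ⁻¹ ≈ y ⁻¹
    inverseʳ  : ∀ x → ¬ (x ≈ 0#) → x * (x ⁻¹) ≈ 1#
    0≉1       : ¬ (0# ≈ 1#)

module FieldDefs {c ℓ} (F : Field c ℓ) where
  open Field F hiding (zero)

  infixl 7 _/_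
  _/_ : Carrier → Carrier → Carrier
  x / y = x * (y ⁻¹)

  2# : Carrier
  2# = 1# + 1#

  infixr 8 _^ℕ_
  _^ℕ_ : Carrier → ℕ → Carrier
  x ^ℕ zero  = 1#
  x ^ℕ suc n = x * (x ^ℕ n)

  infixr 8 _^ℤ_
  _^ℤ_ : Carrier → ℤ → Carrier
  x ^ℤ (+ n)     = x ^ℕ n
  x ^ℤ -[1+ n ]  = (x ⁻¹) ^ℕ suc n

  wPos : Carrier → Carrier → Carrier → Carrier → ℕ → Carrier
  wPos a b p q zero          = a
  wPos a b p q (suc zero)    = b
  wPos a b p q (suc (suc n)) = p * wPos a b p q (suc n) - q * wPos a b p q n

  -- wNeg a b p q n = w_{-n}(a,b;p,q), via w_{-n} = (p w_{-n+1} - w_{-n+2}) / q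
  wNeg : Carrier → Carrier → Carrier → Carrier → ℕ → Carrier
  wNeg a b p q zero          = a
  wNeg a b p q (suc zero)    = (p * a - b) / q
  wNeg a b p q (suc (suc n)) = (p * wNeg a b p q (suc n) - wNeg a b p q n) / q

  w : Carrier → Carrier → Carrier → Carrier → ℤ → Carrier
  w a b p q (+ n)     = wPos a b p q n
  w a b p q -[1+ n ]  = wNeg a b p q (suc n)

  v : Carrier → Carrier → ℤ → Carrier
  v p q = w 2# p p q

  sumTo : ℕ → (ℕ → Carrier) → Carrier
  sumTo zero    f = f zero
  sumTo (suc k) f = sumTo k f + f (suc k)

-- A sequence with x (n + 2) + q x n = p x (n + 1) on all of ℤ is determined by two consecutive
-- values, since q ≠ 0 lets the recurrence run backwards.  For fixed n, both r ↦ w (n + r) + q^r w (n - r)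
-- and r ↦ v r · w n are such sequences and agree at r = 0, 1; this gives the addition formula
-- w (n + r) + q^r w (n - r) = v r · w n.  Hence every progression i ↦ w (b + i r) satisfies the
-- recurrence with parameters (v r, q^r), and the three identities are telescoping sums for such a
-- sequence, weighted by powers of v r / q^r, of 1 / v r, and of -1 / q^r.
module Submission where

open import Defs
open import Data.Nat using (ℕ; zero; suc) renaming (_*_ to _*ℕ_)
open import Data.Integer using (ℤ; +_; -[1+_]) renaming (_+_ to _+ℤ_; _-_ to _-ℤ_; _*_ to _*ℤ_; suc to sucℤ)
import Data.Integer.Properties as ℤ
import Data.Integer.Tactic.RingSolver as ℤSolver
open import Data.Product using (_×_; _,_; proj₁)
open import Function using (_∘_)
open import Relation.Nullary using (¬_)
import Relation.Binary.PropositionalEquality as ≡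
open ≡ using (_≡_)

+-suc : ∀ n r → n +ℤ (+ 1 +ℤ r) ≡ + 1 +ℤ (n +ℤ r)
+-suc = ℤSolver.solve-∀

suc-[-suc] : ∀ n r → + 1 +ℤ (n -ℤ (+ 1 +ℤ r)) ≡ n -ℤ r
suc-[-suc] = ℤSolver.solve-∀

progression-step : ∀ b i r → b +ℤ (+ 1 +ℤ (+ 1 +ℤ i)) *ℤ r ≡ (b +ℤ (+ 1 +ℤ i) *ℤ r) +ℤ r
progression-step = ℤSolver.solve-∀

progression-back : ∀ b i r → b +ℤ i *ℤ r ≡ (b +ℤ (+ 1 +ℤ i) *ℤ r) -ℤ r
progression-back = ℤSolver.solve-∀

module LucasSequences {c ℓ} (F : Field c ℓ) where
  open Field F hiding (zero)
  open FieldDefs F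
  open import Algebra.Properties.Group +-group using (x≈z//y; //-rightDividesˡ; ∙-cancelˡ; ∙-cancelʳ; ⁻¹-involutive; ε⁻¹≈ε)
  open import Algebra.Solver.Ring.NaturalCoefficients.Default commutativeSemiring using (solve; _:=_; _:+_; _:*_; con)
  open import Relation.Binary.Reasoning.Setoid setoid

  cong≈ : ∀ (f : ℤ → Carrier) {i j} → i ≡ j → f i ≈ f j
  cong≈ f = reflexive ∘ ≡.cong f

  sumTo-cong : ∀ k {f g : ℕ → Carrier} → (∀ j → f j ≈ g j) → sumTo k f ≈ sumTo k g
  sumTo-cong zero    f≈g = f≈g zero
  sumTo-cong (suc k) f≈g = +-cong (sumTo-cong k f≈g) (f≈g (suc k))

  *≈1⇒≉0 : ∀ {x y} → x * y ≈ 1# → ¬ (x ≈ 0#)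
  *≈1⇒≉0 {x} {y} xy≈1 x≈0 = 0≉1 (begin
    0#      ≈⟨ zeroˡ y ⟨
    0# * y  ≈⟨ *-congʳ x≈0 ⟨
    x * y   ≈⟨ xy≈1 ⟩
    1#      ∎)

  *-/-cancel : ∀ {x} → ¬ (x ≈ 0#) → ∀ y → x * (y / x) ≈ y
  *-/-cancel {x} x≉0 y = begin
    x * (y * x ⁻¹)  ≈⟨ solve 3 (λ x y x⁻¹ → x :* (y :* x⁻¹) := (x :* x⁻¹) :* y) refl x y (x ⁻¹) ⟩
    x * x ⁻¹ * y    ≈⟨ *-congʳ (inverseʳ x x≉0) ⟩
    1# * y          ≈⟨ *-identityˡ y ⟩
    y               ∎

  *-cancelˡ : ∀ {x y z} → ¬ (x ≈ 0#) → x * y ≈ x * z → y ≈ z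
  *-cancelˡ {x} {y} {z} x≉0 xy≈xz = begin
    y            ≈⟨ *-/-cancel x≉0 y ⟨
    x * (y / x)  ≈⟨ *-assoc x y (x ⁻¹) ⟨
    x * y / x    ≈⟨ *-congʳ xy≈xz ⟩
    x * z / x    ≈⟨ *-assoc x z (x ⁻¹) ⟩
    x * (z / x)  ≈⟨ *-/-cancel x≉0 z ⟩
    z            ∎

  ⁻¹-unique : ∀ {x y} → x * y ≈ 1# → x ⁻¹ ≈ y
  ⁻¹-unique {x} xy≈1 = *-cancelˡ x≉0 (trans (inverseʳ x x≉0) (sym xy≈1))
    where
    x≉0 : ¬ (x ≈ 0#)
    x≉0 = *≈1⇒≉0 xy≈1

  ^ℕ-*-inverse : ∀ {x y} n → x * y ≈ 1# → x ^ℕ n * y ^ℕ n ≈ 1#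
  ^ℕ-*-inverse zero    xy≈1 = *-identityˡ 1#
  ^ℕ-*-inverse {x} {y} (suc n) xy≈1 = begin
    x * x ^ℕ n * (y * y ^ℕ n)      ≈⟨ solve 4 (λ x y xₙ yₙ → x :* xₙ :* (y :* yₙ) := (x :* y) :* (xₙ :* yₙ))
                                              refl x y (x ^ℕ n) (y ^ℕ n) ⟩
    x * y * (x ^ℕ n * y ^ℕ n)      ≈⟨ *-cong xy≈1 (^ℕ-*-inverse n xy≈1) ⟩
    1# * 1#                        ≈⟨ *-identityˡ 1# ⟩
    1#                             ∎

  /-^ℕ : ∀ {x y} z n → x * y ≈ 1# → z / x ^ℕ n ≈ z * y ^ℕ n
  /-^ℕ z n xy≈1 = *-congˡ (⁻¹-unique (^ℕ-*-inverse n xy≈1))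

  ^ℤ-≉0 : ∀ {x} → ¬ (x ≈ 0#) → ∀ r → ¬ (x ^ℤ r ≈ 0#)
  ^ℤ-≉0 x≉0 (+ n)    = *≈1⇒≉0 (^ℕ-*-inverse n (inverseʳ _ x≉0))
  ^ℤ-≉0 x≉0 -[1+ n ] = *≈1⇒≉0 (^ℕ-*-inverse (suc n) (trans (*-comm _ _) (inverseʳ _ x≉0)))

  ^ℤ-suc : ∀ {x} → ¬ (x ≈ 0#) → ∀ r → x ^ℤ sucℤ r ≈ x * x ^ℤ r
  ^ℤ-suc x≉0 (+ n)          = refl
  ^ℤ-suc x≉0 -[1+ zero ]    = sym (trans (*-congˡ (*-identityʳ _)) (inverseʳ _ x≉0))
  ^ℤ-suc {x} x≉0 -[1+ suc n ] = sym (trans (*-congˡ (*-comm (x ⁻¹) _)) (*-/-cancel x≉0 _))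

  -- Stated without subtraction, so that the commutative-semiring solver handles all the algebra.
  IsLucas : Carrier → Carrier → (ℤ → Carrier) → Set ℓ
  IsLucas p q f = ∀ n → f (sucℤ (sucℤ n)) + q * f n ≈ p * f (sucℤ n)

  x+q*[[z-x]/q]≈z : ∀ {q} → ¬ (q ≈ 0#) → ∀ x z → x + q * ((z - x) / q) ≈ z
  x+q*[[z-x]/q]≈z {q} q≉0 x z = begin
    x + q * ((z - x) / q)  ≈⟨ +-congˡ (*-/-cancel q≉0 (z - x)) ⟩
    x + (z - x)            ≈⟨ +-comm x _ ⟩
    z - x + x              ≈⟨ //-rightDividesˡ x z ⟩
    z                      ∎

  w-isLucas : ∀ {q} → ¬ (q ≈ 0#) → ∀ a b p → IsLucas p q (w a b p q)
  w-isLucas q≉0 a b p (+ n)              = //-rightDividesˡ _ _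
  w-isLucas q≉0 a b p -[1+ zero ]        = x+q*[[z-x]/q]≈z q≉0 b (p * a)
  w-isLucas q≉0 a b p -[1+ suc zero ]    = x+q*[[z-x]/q]≈z q≉0 a _
  w-isLucas q≉0 a b p -[1+ suc (suc n) ] = x+q*[[z-x]/q]≈z q≉0 _ _

  module _ {p q : Carrier} (q≉0 : ¬ (q ≈ 0#)) {f g : ℤ → Carrier}
           (f-lucas : IsLucas p q f) (g-lucas : IsLucas p q g) where

    private
      Agree : ℤ → Set ℓ
      Agree n = f n ≈ g n × f (sucℤ n) ≈ g (sucℤ n)

      agree-up : ∀ n → Agree n → Agree (sucℤ n)
      agree-up n (fn≈gn , f₁≈g₁) = f₁≈g₁ , ∙-cancelʳ (q * f n) _ _ (begin
        f (sucℤ (sucℤ n)) + q * f n  ≈⟨ f-lucas n ⟩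
        p * f (sucℤ n)               ≈⟨ *-congˡ f₁≈g₁ ⟩
        p * g (sucℤ n)               ≈⟨ g-lucas n ⟨
        g (sucℤ (sucℤ n)) + q * g n  ≈⟨ +-congˡ (*-congˡ fn≈gn) ⟨
        g (sucℤ (sucℤ n)) + q * f n  ∎)

      agree-down : ∀ n → Agree (sucℤ n) → Agree n
      agree-down n (f₁≈g₁ , f₂≈g₂) = *-cancelˡ q≉0 (∙-cancelˡ (f (sucℤ (sucℤ n))) _ _ (begin
        f (sucℤ (sucℤ n)) + q * f n  ≈⟨ f-lucas n ⟩
        p * f (sucℤ n)               ≈⟨ *-congˡ f₁≈g₁ ⟩
        p * g (sucℤ n)               ≈⟨ g-lucas n ⟨
        g (sucℤ (sucℤ n)) + q * g n  ≈⟨ +-congʳ f₂≈g₂ ⟨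
        f (sucℤ (sucℤ n)) + q * g n  ∎)) , f₁≈g₁

    lucas-unique : f (+ 0) ≈ g (+ 0) → f (+ 1) ≈ g (+ 1) → ∀ n → f n ≈ g n
    lucas-unique f₀≈g₀ f₁≈g₁ = proj₁ ∘ agree
      where
      agree-+ : ∀ n → Agree (+ n)
      agree-+ zero    = f₀≈g₀ , f₁≈g₁
      agree-+ (suc n) = agree-up (+ n) (agree-+ n)

      agree-- : ∀ n → Agree -[1+ n ]
      agree-- zero    = agree-down -[1+ 0 ] (agree-+ 0)
      agree-- (suc n) = agree-down -[1+ suc n ] (agree-- n)

      agree : ∀ n → Agree n
      agree (+ n)    = agree-+ n
      agree -[1+ n ] = agree-- n

  isLucas-shift : ∀ {p q f} → IsLucas p q f → ∀ n → IsLucas p q (λ r → f (n +ℤ r))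
  isLucas-shift {p} {q} {f} f-lucas n r = begin
    f (n +ℤ sucℤ (sucℤ r)) + q * f (n +ℤ r)
      ≈⟨ +-congʳ (cong≈ f (≡.trans (+-suc n (sucℤ r)) (≡.cong sucℤ (+-suc n r)))) ⟩
    f (sucℤ (sucℤ (n +ℤ r))) + q * f (n +ℤ r)
      ≈⟨ f-lucas (n +ℤ r) ⟩
    p * f (sucℤ (n +ℤ r))
      ≈⟨ *-congˡ (cong≈ f (+-suc n r)) ⟨
    p * f (n +ℤ sucℤ r)
      ∎

  isLucas-reflect : ∀ {p q f} → ¬ (q ≈ 0#) → IsLucas p q f → ∀ n → IsLucas p q (λ r → q ^ℤ r * f (n -ℤ r))
  isLucas-reflect {p} {q} {f} q≉0 f-lucas n r = begin
    q ^ℤ sucℤ (sucℤ r) * f m + q * (qʳ * f (n -ℤ r))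
      ≈⟨ +-cong (*-congʳ (trans (^ℤ-suc q≉0 (sucℤ r)) (*-congˡ (^ℤ-suc q≉0 r))))
                (*-congˡ (*-congˡ (cong≈ f (≡.sym m+2≡n-r)))) ⟩
    q * (q * qʳ) * f m + q * (qʳ * f (sucℤ (sucℤ m)))
      ≈⟨ solve 4 (λ q qʳ f₀ f₂ → q :* (q :* qʳ) :* f₀ :+ q :* (qʳ :* f₂) := q :* qʳ :* (f₂ :+ q :* f₀))
               refl q qʳ (f m) (f (sucℤ (sucℤ m))) ⟩
    q * qʳ * (f (sucℤ (sucℤ m)) + q * f m)
      ≈⟨ *-congˡ (f-lucas m) ⟩
    q * qʳ * (p * f (sucℤ m))
      ≈⟨ solve 4 (λ p q qʳ f₁ → q :* qʳ :* (p :* f₁) := p :* (q :* qʳ :* f₁)) refl p q qʳ (f (sucℤ m)) ⟩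
    p * (q * qʳ * f (sucℤ m))
      ≈⟨ *-congˡ (*-cong (^ℤ-suc q≉0 r) (cong≈ f (≡.sym (suc-[-suc] n (sucℤ r))))) ⟨
    p * (q ^ℤ sucℤ r * f (n -ℤ sucℤ r))
      ∎
    where
    qʳ : Carrier
    qʳ = q ^ℤ r
    m : ℤ
    m = n -ℤ sucℤ (sucℤ r)
    m+2≡n-r : sucℤ (sucℤ m) ≡ n -ℤ r
    m+2≡n-r = ≡.trans (≡.cong sucℤ (suc-[-suc] n (sucℤ r))) (suc-[-suc] n r)

  isLucas-+ : ∀ {p q f g} → IsLucas p q f → IsLucas p q g → IsLucas p q (λ n → f n + g n)
  isLucas-+ {p} {q} {f} {g} f-lucas g-lucas n = begin
    f (sucℤ (sucℤ n)) + g (sucℤ (sucℤ n)) + q * (f n + g n)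
      ≈⟨ solve 5 (λ q f₂ g₂ f₀ g₀ → f₂ :+ g₂ :+ q :* (f₀ :+ g₀) := (f₂ :+ q :* f₀) :+ (g₂ :+ q :* g₀))
               refl q (f (sucℤ (sucℤ n))) (g (sucℤ (sucℤ n))) (f n) (g n) ⟩
    (f (sucℤ (sucℤ n)) + q * f n) + (g (sucℤ (sucℤ n)) + q * g n)
      ≈⟨ +-cong (f-lucas n) (g-lucas n) ⟩
    p * f (sucℤ n) + p * g (sucℤ n)
      ≈⟨ distribˡ p _ _ ⟨
    p * (f (sucℤ n) + g (sucℤ n))
      ∎

  isLucas-*ʳ : ∀ {p q f} → IsLucas p q f → ∀ c → IsLucas p q (λ n → f n * c)
  isLucas-*ʳ {p} {q} {f} f-lucas c n = begin
    f (sucℤ (sucℤ n)) * c + q * (f n * c)  ≈⟨ solve 4 (λ q c f₂ f₀ → f₂ :* c :+ q :* (f₀ :* c) := (f₂ :+ q :* f₀) :* c)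
                                                     refl q c (f (sucℤ (sucℤ n))) (f n) ⟩
    (f (sucℤ (sucℤ n)) + q * f n) * c      ≈⟨ *-congʳ (f-lucas n) ⟩
    p * f (sucℤ n) * c                     ≈⟨ *-assoc p _ c ⟩
    p * (f (sucℤ n) * c)                   ∎

  lucas-addition : ∀ {p q f} → ¬ (q ≈ 0#) → IsLucas p q f →
                   ∀ n r → f (n +ℤ r) + q ^ℤ r * f (n -ℤ r) ≈ v p q r * f n
  lucas-addition {p} {q} {f} q≉0 f-lucas n =
    lucas-unique q≉0 (isLucas-+ (isLucas-shift f-lucas n) (isLucas-reflect q≉0 f-lucas n))
                     (isLucas-*ʳ (w-isLucas q≉0 2# p p) (f n)) at-0 at-1
    where
    at-0 : f (n +ℤ + 0) + 1# * f (n -ℤ + 0) ≈ 2# * f n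
    at-0 = begin
      f (n +ℤ + 0) + 1# * f (n +ℤ + 0)  ≈⟨ +-cong (cong≈ f (ℤ.+-identityʳ n)) (*-congˡ (cong≈ f (ℤ.+-identityʳ n))) ⟩
      f n + 1# * f n                    ≈⟨ solve 1 (λ x → x :+ con 1 :* x := (con 1 :+ con 1) :* x) refl (f n) ⟩
      2# * f n                          ∎
    n-1+1≡n : sucℤ (n -ℤ + 1) ≡ n
    n-1+1≡n = ≡.trans (suc-[-suc] n (+ 0)) (ℤ.+-identityʳ n)
    at-1 : f (n +ℤ + 1) + q * 1# * f (n -ℤ + 1) ≈ p * f n
    at-1 = begin
      f (n +ℤ + 1) + q * 1# * f (n -ℤ + 1)
        ≈⟨ +-cong (cong≈ f (≡.trans (ℤ.+-comm n (+ 1)) (≡.cong sucℤ (≡.sym n-1+1≡n))))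
                  (*-congʳ (*-identityʳ q)) ⟩
      f (sucℤ (sucℤ (n -ℤ + 1))) + q * f (n -ℤ + 1)  ≈⟨ f-lucas (n -ℤ + 1) ⟩
      p * f (sucℤ (n -ℤ + 1))                        ≈⟨ *-congˡ (cong≈ f n-1+1≡n) ⟩
      p * f n                                        ∎

  isLucas-progression : ∀ {p q f} → ¬ (q ≈ 0#) → IsLucas p q f →
                        ∀ b r → IsLucas (v p q r) (q ^ℤ r) (λ i → f (b +ℤ i *ℤ r))
  isLucas-progression {p} {q} {f} q≉0 f-lucas b r i = begin
    f (b +ℤ sucℤ (sucℤ i) *ℤ r) + q ^ℤ r * f (b +ℤ i *ℤ r)
      ≈⟨ +-cong (cong≈ f (progression-step b i r)) (*-congˡ (cong≈ f (progression-back b i r))) ⟩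
    f (n +ℤ r) + q ^ℤ r * f (n -ℤ r)
      ≈⟨ lucas-addition q≉0 f-lucas n r ⟩
    v p q r * f n
      ∎
    where
    n : ℤ
    n = b +ℤ sucℤ i *ℤ r

  module _ {V Q : Carrier} {f : ℤ → Carrier} (f-lucas : IsLucas V Q f) where

    lucas-telescope-shifted : ∀ {e} → V ≈ e * Q → ∀ k →
      sumTo k (λ j → f (+ suc (suc j)) * e ^ℕ j) + Q * f (+ 0) ≈ V * f (+ suc k) * e ^ℕ k
    lucas-telescope-shifted V≈eQ zero = begin
      f (+ 2) * 1# + Q * f (+ 0)  ≈⟨ +-congʳ (*-identityʳ _) ⟩
      f (+ 2) + Q * f (+ 0)       ≈⟨ f-lucas (+ 0) ⟩
      V * f (+ 1)                 ≈⟨ *-identityʳ _ ⟨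
      V * f (+ 1) * 1#            ∎
    lucas-telescope-shifted {e} V≈eQ (suc k) = begin
      S + f₃ * (e * E) + Q * f₀      ≈⟨ solve 6 (λ S f₃ e E Q f₀ → S :+ f₃ :* (e :* E) :+ Q :* f₀ := S :+ Q :* f₀ :+ f₃ :* (e :* E))
                                               refl S f₃ e E Q f₀ ⟩
      S + Q * f₀ + f₃ * (e * E)      ≈⟨ +-congʳ (lucas-telescope-shifted V≈eQ k) ⟩
      V * f₁ * E + f₃ * (e * E)      ≈⟨ +-congʳ (*-congʳ (*-congʳ V≈eQ)) ⟩
      e * Q * f₁ * E + f₃ * (e * E)  ≈⟨ solve 5 (λ e Q f₁ E f₃ → e :* Q :* f₁ :* E :+ f₃ :* (e :* E) := (f₃ :+ Q :* f₁) :* (e :* E))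
                                               refl e Q f₁ E f₃ ⟩
      (f₃ + Q * f₁) * (e * E)        ≈⟨ *-congʳ (f-lucas (+ suc k)) ⟩
      V * f₂ * (e * E)               ∎
      where
      S E f₀ f₁ f₂ f₃ : Carrier
      S = sumTo k (λ j → f (+ suc (suc j)) * e ^ℕ j)
      E = e ^ℕ k
      f₀ = f (+ 0)
      f₁ = f (+ suc k)
      f₂ = f (+ suc (suc k))
      f₃ = f (+ suc (suc (suc k)))

    lucas-telescope : ∀ {e} → V * e ≈ 1# → ∀ k →
      V ^ℕ k * Q * sumTo k (λ j → f (+ j) * e ^ℕ j) + f (+ suc (suc k)) ≈ V ^ℕ suc k * f (+ 1)
    lucas-telescope Ve≈1 zero = begin
      1# * Q * (f (+ 0) * 1#) + f (+ 2)  ≈⟨ solve 3 (λ Q f₀ f₂ → con 1 :* Q :* (f₀ :* con 1) :+ f₂ := f₂ :+ Q :* f₀)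
                                                   refl Q (f (+ 0)) (f (+ 2)) ⟩
      f (+ 2) + Q * f (+ 0)              ≈⟨ f-lucas (+ 0) ⟩
      V * f (+ 1)                        ≈⟨ *-congʳ (*-identityʳ V) ⟨
      V * 1# * f (+ 1)                   ∎
    lucas-telescope {e} Ve≈1 (suc k) = begin
      V * Vᵏ * Q * (S + f₁ * (e * E)) + f₃
        ≈⟨ solve 8 (λ V Vᵏ Q S f₁ e E f₃ → V :* Vᵏ :* Q :* (S :+ f₁ :* (e :* E)) :+ f₃
                                          := V :* (Vᵏ :* Q :* S) :+ Q :* f₁ :* (V :* e :* (Vᵏ :* E)) :+ f₃)
                 refl V Vᵏ Q S f₁ e E f₃ ⟩
      V * (Vᵏ * Q * S) + Q * f₁ * (V * e * (Vᵏ * E)) + f₃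
        ≈⟨ +-congʳ (+-congˡ (*-congˡ (*-cong Ve≈1 (^ℕ-*-inverse k Ve≈1)))) ⟩
      V * (Vᵏ * Q * S) + Q * f₁ * (1# * 1#) + f₃
        ≈⟨ solve 5 (λ V T Q f₁ f₃ → V :* T :+ Q :* f₁ :* (con 1 :* con 1) :+ f₃ := V :* T :+ (f₃ :+ Q :* f₁))
                 refl V (Vᵏ * Q * S) Q f₁ f₃ ⟩
      V * (Vᵏ * Q * S) + (f₃ + Q * f₁)
        ≈⟨ +-congˡ (f-lucas (+ suc k)) ⟩
      V * (Vᵏ * Q * S) + V * f₂
        ≈⟨ distribˡ V _ _ ⟨
      V * (Vᵏ * Q * S + f₂)
        ≈⟨ *-congˡ (lucas-telescope Ve≈1 k) ⟩
      V * (V * Vᵏ * f (+ 1))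
        ≈⟨ *-assoc V _ _ ⟨
      V * (V * Vᵏ) * f (+ 1)
        ∎
      where
      S Vᵏ E f₁ f₂ f₃ : Carrier
      S = sumTo k (λ j → f (+ j) * e ^ℕ j)
      Vᵏ = V ^ℕ k
      E = e ^ℕ k
      f₁ = f (+ suc k)
      f₂ = f (+ suc (suc k))
      f₃ = f (+ suc (suc (suc k)))

    lucas-telescope-odd : ∀ {g} → 1# + Q * g ≈ 0# → ∀ k →
      V * sumTo k (λ j → f (+ suc (j *ℕ 2)) * g ^ℕ j) ≈ f (+ suc (suc (k *ℕ 2))) * g ^ℕ k + Q * f (+ 0)
    lucas-telescope-odd 1+Qg≈0 zero = begin
      V * (f (+ 1) * 1#)          ≈⟨ *-congˡ (*-identityʳ _) ⟩
      V * f (+ 1)                 ≈⟨ f-lucas (+ 0) ⟨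
      f (+ 2) + Q * f (+ 0)       ≈⟨ +-congʳ (*-identityʳ _) ⟨
      f (+ 2) * 1# + Q * f (+ 0)  ∎
    lucas-telescope-odd {g} 1+Qg≈0 (suc k) = begin
      V * (S + f₃ * (g * G))
        ≈⟨ solve 5 (λ V S f₃ g G → V :* (S :+ f₃ :* (g :* G)) := V :* S :+ V :* f₃ :* (g :* G)) refl V S f₃ g G ⟩
      V * S + V * f₃ * (g * G)
        ≈⟨ +-cong (lucas-telescope-odd 1+Qg≈0 k) (*-congʳ (sym (f-lucas (+ suc (suc (k *ℕ 2)))))) ⟩
      f₂ * G + Q * f₀ + (f₄ + Q * f₂) * (g * G)
        ≈⟨ solve 6 (λ f₂ G Q f₀ f₄ g → f₂ :* G :+ Q :* f₀ :+ (f₄ :+ Q :* f₂) :* (g :* G)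
                                       := f₄ :* (g :* G) :+ Q :* f₀ :+ (con 1 :+ Q :* g) :* (f₂ :* G))
                 refl f₂ G Q f₀ f₄ g ⟩
      f₄ * (g * G) + Q * f₀ + (1# + Q * g) * (f₂ * G)
        ≈⟨ +-congˡ (trans (*-congʳ 1+Qg≈0) (zeroˡ _)) ⟩
      f₄ * (g * G) + Q * f₀ + 0#
        ≈⟨ +-identityʳ _ ⟩
      f₄ * (g * G) + Q * f₀
        ∎
      where
      S G f₀ f₂ f₃ f₄ : Carrier
      S = sumTo k (λ j → f (+ suc (j *ℕ 2)) * g ^ℕ j)
      G = g ^ℕ k
      f₀ = f (+ 0)
      f₂ = f (+ suc (suc (k *ℕ 2)))
      f₃ = f (+ suc (suc (suc (k *ℕ 2))))
      f₄ = f (+ suc (suc (suc (suc (k *ℕ 2)))))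

  lucas-sum-ratio : ∀ {p q f} → ¬ (q ≈ 0#) → IsLucas p q f → ∀ k r m → ¬ (v p q r ≈ 0#) →
    sumTo k (λ j → f (m -ℤ (+ k) *ℤ r +ℤ r +ℤ r *ℤ (+ j)) / ((q ^ℤ r / v p q r) ^ℕ j))
      ≈ v p q r * f m / ((q ^ℤ r / v p q r) ^ℕ k) - q ^ℤ r * f (m -ℤ (+ suc k) *ℤ r)
  lucas-sum-ratio {p} {q} {f} q≉0 f-lucas k r m V≉0 = x≈z//y _ _ _ (begin
    sumTo k (λ j → f (m -ℤ + k *ℤ r +ℤ r +ℤ r *ℤ + j) / (Q / V) ^ℕ j) + Q * f b
      ≈⟨ +-cong (sumTo-cong k term) (*-congˡ (cong≈ f (≡.sym (first-term b r)))) ⟩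
    sumTo k (λ j → y (+ suc (suc j)) * e ^ℕ j) + Q * y (+ 0)
      ≈⟨ lucas-telescope-shifted (isLucas-progression q≉0 f-lucas b r) V≈eQ k ⟩
    V * y (+ suc k) * e ^ℕ k
      ≈⟨ trans (*-congʳ (*-congˡ (cong≈ f (last-term m (+ suc k) r)))) (sym (/-^ℕ _ k Q/V*e≈1)) ⟩
    V * f m / (Q / V) ^ℕ k
      ∎)
    where
    Q V e : Carrier
    Q = q ^ℤ r
    V = v p q r
    e = V / Q
    b : ℤ
    b = m -ℤ + suc k *ℤ r
    y : ℤ → Carrier
    y i = f (b +ℤ i *ℤ r)
    Q≉0 : ¬ (Q ≈ 0#)
    Q≉0 = ^ℤ-≉0 q≉0 r
    Q/V*e≈1 : Q / V * e ≈ 1#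
    Q/V*e≈1 = begin
      Q * V ⁻¹ * (V * Q ⁻¹)  ≈⟨ solve 4 (λ Q V⁻¹ V Q⁻¹ → Q :* V⁻¹ :* (V :* Q⁻¹) := Q :* Q⁻¹ :* (V :* V⁻¹))
                                        refl Q (V ⁻¹) V (Q ⁻¹) ⟩
      Q * Q ⁻¹ * (V * V ⁻¹)  ≈⟨ *-cong (inverseʳ Q Q≉0) (inverseʳ V V≉0) ⟩
      1# * 1#                ≈⟨ *-identityˡ 1# ⟩
      1#                     ∎
    V≈eQ : V ≈ e * Q
    V≈eQ = sym (trans (*-comm e Q) (*-/-cancel Q≉0 V))
    index : ∀ m k r j → m -ℤ k *ℤ r +ℤ r +ℤ r *ℤ j ≡ (m -ℤ (+ 1 +ℤ k) *ℤ r) +ℤ (+ 2 +ℤ j) *ℤ r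
    index = ℤSolver.solve-∀
    first-term : ∀ b r → b +ℤ + 0 *ℤ r ≡ b
    first-term = ℤSolver.solve-∀
    last-term : ∀ m i r → (m -ℤ i *ℤ r) +ℤ i *ℤ r ≡ m
    last-term = ℤSolver.solve-∀
    term : ∀ j → f (m -ℤ + k *ℤ r +ℤ r +ℤ r *ℤ + j) / (Q / V) ^ℕ j ≈ y (+ suc (suc j)) * e ^ℕ j
    term j = trans (/-^ℕ _ j Q/V*e≈1) (*-congʳ (cong≈ f (index m (+ k) r (+ j))))

  lucas-sum-v : ∀ {p q f} → ¬ (q ≈ 0#) → IsLucas p q f → ∀ k r m → ¬ (v p q r ≈ 0#) →
    (v p q r ^ℕ k) * (q ^ℤ r) * sumTo k (λ j → f (m -ℤ r +ℤ r *ℤ (+ j)) / (v p q r ^ℕ j))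
      ≈ (v p q r ^ℕ suc k) * f m - f (m +ℤ (+ suc k) *ℤ r)
  lucas-sum-v {p} {q} {f} q≉0 f-lucas k r m V≉0 = x≈z//y _ _ _ (begin
    V ^ℕ k * Q * sumTo k (λ j → f (m -ℤ r +ℤ r *ℤ + j) / V ^ℕ j) + f (m +ℤ + suc k *ℤ r)
      ≈⟨ +-cong (*-congˡ (sumTo-cong k term)) (cong≈ f (≡.sym (last-term m (+ k) r))) ⟩
    V ^ℕ k * Q * sumTo k (λ j → y (+ j) * V ⁻¹ ^ℕ j) + y (+ suc (suc k))
      ≈⟨ lucas-telescope (isLucas-progression q≉0 f-lucas (m -ℤ r) r) (inverseʳ V V≉0) k ⟩
    V ^ℕ suc k * y (+ 1)
      ≈⟨ *-congˡ (cong≈ f (second-term m r)) ⟩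
    V ^ℕ suc k * f m
      ∎)
    where
    Q V : Carrier
    Q = q ^ℤ r
    V = v p q r
    y : ℤ → Carrier
    y i = f (m -ℤ r +ℤ i *ℤ r)
    index : ∀ m r j → m -ℤ r +ℤ r *ℤ j ≡ (m -ℤ r) +ℤ j *ℤ r
    index = ℤSolver.solve-∀
    second-term : ∀ m r → (m -ℤ r) +ℤ + 1 *ℤ r ≡ m
    second-term = ℤSolver.solve-∀
    last-term : ∀ m k r → (m -ℤ r) +ℤ (+ 2 +ℤ k) *ℤ r ≡ m +ℤ (+ 1 +ℤ k) *ℤ r
    last-term = ℤSolver.solve-∀
    term : ∀ j → f (m -ℤ r +ℤ r *ℤ + j) / V ^ℕ j ≈ y (+ j) * V ⁻¹ ^ℕ j
    term j = trans (/-^ℕ _ j (inverseʳ V V≉0)) (*-congʳ (cong≈ f (index m r (+ j))))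

  lucas-sum-neg : ∀ {p q f} → ¬ (q ≈ 0#) → IsLucas p q f → ∀ k r m →
    v p q r * sumTo k (λ j → f (m -ℤ (+ 2) *ℤ (+ k) *ℤ r -ℤ r +ℤ (+ 2) *ℤ r *ℤ (+ j)) / ((- (q ^ℤ r)) ^ℕ j))
      ≈ f m / ((- (q ^ℤ r)) ^ℕ k) + q ^ℤ r * f (m -ℤ (+ 2) *ℤ (+ suc k) *ℤ r)
  lucas-sum-neg {p} {q} {f} q≉0 f-lucas k r m = begin
    V * sumTo k (λ j → f (m -ℤ + 2 *ℤ + k *ℤ r -ℤ r +ℤ + 2 *ℤ r *ℤ + j) / (- Q) ^ℕ j)
      ≈⟨ *-congˡ (sumTo-cong k term) ⟩
    V * sumTo k (λ j → y (+ suc (j *ℕ 2)) * g ^ℕ j)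
      ≈⟨ lucas-telescope-odd (isLucas-progression q≉0 f-lucas b r) 1+Qg≈0 k ⟩
    y (+ suc (suc (k *ℕ 2))) * g ^ℕ k + Q * y (+ 0)
      ≈⟨ +-cong (trans (*-congʳ (cong≈ f last-term)) (sym (/-^ℕ _ k -Q*g≈1)))
                (*-congˡ (cong≈ f (first-term b r))) ⟩
    f m / (- Q) ^ℕ k + Q * f b
      ∎
    where
    Q V g : Carrier
    Q = q ^ℤ r
    V = v p q r
    g = (- Q) ⁻¹
    b : ℤ
    b = m -ℤ + 2 *ℤ + suc k *ℤ r
    y : ℤ → Carrier
    y i = f (b +ℤ i *ℤ r)
    -Q≉0 : ¬ (- Q ≈ 0#)
    -Q≉0 -Q≈0 = ^ℤ-≉0 q≉0 r (trans (sym (⁻¹-involutive Q)) (trans (-‿cong -Q≈0) ε⁻¹≈ε))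
    -Q*g≈1 : - Q * g ≈ 1#
    -Q*g≈1 = inverseʳ (- Q) -Q≉0
    1+Qg≈0 : 1# + Q * g ≈ 0#
    1+Qg≈0 = begin
      1# + Q * g      ≈⟨ +-congʳ -Q*g≈1 ⟨
      - Q * g + Q * g  ≈⟨ distribʳ g (- Q) Q ⟨
      (- Q + Q) * g    ≈⟨ *-congʳ (-‿inverseˡ Q) ⟩
      0# * g           ≈⟨ zeroˡ g ⟩
      0#               ∎
    index : ∀ m k r j → m -ℤ + 2 *ℤ k *ℤ r -ℤ r +ℤ + 2 *ℤ r *ℤ j
                      ≡ (m -ℤ + 2 *ℤ (+ 1 +ℤ k) *ℤ r) +ℤ (+ 1 +ℤ j *ℤ + 2) *ℤ r
    index = ℤSolver.solve-∀
    first-term : ∀ b r → b +ℤ + 0 *ℤ r ≡ b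
    first-term = ℤSolver.solve-∀
    last-index : ∀ m k r → (m -ℤ + 2 *ℤ (+ 1 +ℤ k) *ℤ r) +ℤ (+ 2 +ℤ k *ℤ + 2) *ℤ r ≡ m
    last-index = ℤSolver.solve-∀
    last-term : b +ℤ + suc (suc (k *ℕ 2)) *ℤ r ≡ m
    last-term = ≡.trans (≡.cong (λ t → b +ℤ (+ 2 +ℤ t) *ℤ r) (ℤ.pos-* k 2)) (last-index m (+ k) r)
    term : ∀ j → f (m -ℤ + 2 *ℤ + k *ℤ r -ℤ r +ℤ + 2 *ℤ r *ℤ + j) / (- Q) ^ℕ j ≈ y (+ suc (j *ℕ 2)) * g ^ℕ j
    term j = trans (/-^ℕ _ j -Q*g≈1)
                   (*-congʳ (cong≈ f (≡.trans (index m (+ k) r (+ j))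
                                              (≡.cong (λ t → b +ℤ (+ 1 +ℤ t) *ℤ r) (≡.sym (ℤ.pos-* j 2))))))

theorem6 : ∀ {c ℓ} (F : Field c ℓ) → let open Field F in let open FieldDefs F in
    (a b p q : Carrier) → ¬ (p ≈ 0#) → ¬ (q ≈ 0#) →
    (k : ℕ) (r m : ℤ) → ¬ (v p q r ≈ 0#) →
      (sumTo k (λ j → w a b p q (m -ℤ (+ k) *ℤ r +ℤ r +ℤ r *ℤ (+ j)) / ((q ^ℤ r / v p q r) ^ℕ j))
         ≈ v p q r * w a b p q m / ((q ^ℤ r / v p q r) ^ℕ k) - q ^ℤ r * w a b p q (m -ℤ (+ suc k) *ℤ r))
    × ((v p q r ^ℕ k) * (q ^ℤ r) * sumTo k (λ j → w a b p q (m -ℤ r +ℤ r *ℤ (+ j)) / (v p q r ^ℕ j))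
         ≈ (v p q r ^ℕ suc k) * w a b p q m - w a b p q (m +ℤ (+ suc k) *ℤ r))
    × (v p q r * sumTo k (λ j → w a b p q (m -ℤ (+ 2) *ℤ (+ k) *ℤ r -ℤ r +ℤ (+ 2) *ℤ r *ℤ (+ j)) / ((- (q ^ℤ r)) ^ℕ j))
         ≈ w a b p q m / ((- (q ^ℤ r)) ^ℕ k) + q ^ℤ r * w a b p q (m -ℤ (+ 2) *ℤ (+ suc k) *ℤ r))
theorem6 F a b p q _ q≉0 k r m vᵣ≉0 =
    lucas-sum-ratio q≉0 w-lucas k r m vᵣ≉0
  , lucas-sum-v q≉0 w-lucas k r m vᵣ≉0
  , lucas-sum-neg q≉0 w-lucas k r m
  where
  open FieldDefs F
  open LucasSequences F
  w-lucas : IsLucas p q (w a b p q)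
  w-lucas = w-isLucas q≉0 a b p
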